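{- For every $\langle A,B,C\rangle\in\mathcal{T}$, the triple $\overline{\langle A,B,C\rangle}$ also belongs to $\mathcal{T}$.
   Context: Let $\kappa$ be an infinite cardinal, identified with the set of ordinals less than $\kappa$. Let $\mathcal{F}(\kappa)=\{X\subseteq\kappa : X \text{ is finite or } \kappa\setminus X \text{ is finite}\}$. For subsets $A,B,C\subseteq\kappa$ put $\mu\langle A,B,C\rangle=(A\cap B)\cup(A\cap C)\cup(B\cap C)$ and $\overline{\langle A,B,C\rangle}=\langle A\cup\mu\langle A,B,C\rangle,\ B\cup\mu\langle A,B,C\rangle,\ C\cup\mu\langle A,B,C\rangle\rangle$. Define $\mathcal{T}=\{\langle A,B,C\rangle\in\mathcal{F}(\kappa)^3 : C\setminus\mu\langle A,B,C\rangle \text{ is finite}\}$. -}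

module Defs where

open import Data.Bool using (Bool; true; false; _∧_; _∨_; not)
open import Data.List using (List)
open import Data.List.Membership.Propositional using (_∈_)
open import Data.Product using (Σ; _×_)
open import Relation.Binary.PropositionalEquality using (_≡_)
open import Relation.Nullary using (¬_)

Subset : Set → Set
Subset K = K → Bool

module _ {K : Set} where

  _∩_ : Subset K → Subset K → Subset K
  (X ∩ Y) x = X x ∧ Y x

  _∪_ : Subset K → Subset K → Subset K
  (X ∪ Y) x = X x ∨ Y x

  _∖_ : Subset K → Subset K → Subset K
  (X ∖ Y) x = X x ∧ not (Y x)

  IsFinite : Subset K → Set
  IsFinite X = Σ (List K) λ xs → ∀ x → X x ≡ true → x ∈ xs

  IsCofinite : Subset K → Set
  IsCofinite X = Σ (List K) λ xs → ∀ x → X x ≡ false → x ∈ xs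

  data InF (X : Subset K) : Set where
    fin   : IsFinite X → InF X
    cofin : IsCofinite X → InF X

  μ : Subset K → Subset K → Subset K → Subset K
  μ A B C = ((A ∩ B) ∪ (A ∩ C)) ∪ (B ∩ C)

  record Triple : Set where
    constructor ⟨_,_,_⟩
    field
      fst snd thd : Subset K

  closure : Triple → Triple
  closure ⟨ A , B , C ⟩ =
    ⟨ A ∪ μ A B C , B ∪ μ A B C , C ∪ μ A B C ⟩

  InT : Triple → Set
  InT ⟨ A , B , C ⟩ = InF A × InF B × InF C × IsFinite (C ∖ μ A B C)

Infinite : Set → Set
Infinite K = ¬ (Σ (List K) λ xs → ∀ (x : K) → x ∈ xs)

-- The finite-cofinite algebra is closed under ∪ and ∩, so every component of
-- the closure lies in F(κ) again.  The closure does not change C ∖ μ⟨A,B,C⟩: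
-- a point of μ⟨A,B,C⟩ stays in μ of the closure, and a point outside it lies
-- in at most one of A, B, C, where the closure changes nothing.
module Submission where

open import Defs
open import Algebra.Definitions using (Selective; LeftConical; RightConical)
open import Data.Bool using (Bool; true; false; _∧_; _∨_; not)
open import Data.Bool.Properties
  using (∨-sel; ∧-sel; ∨-conicalˡ; ∨-conicalʳ; ∧-conicalˡ; ∧-conicalʳ)
open import Data.List using (List; _++_)
open import Data.List.Membership.Propositional using (_∈_)
open import Data.List.Membership.Propositional.Properties using (∈-++⁺ˡ; ∈-++⁺ʳ)
open import Data.Product using (_,_)
open import Data.Sum using (inj₁; inj₂)
open import Relation.Binary.PropositionalEquality using (_≡_; refl; sym; trans)

majority : Bool → Bool → Bool → Bool
majority a b c = (a ∧ b ∨ a ∧ c) ∨ b ∧ c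

majority-closure : ∀ a b c → let m = majority a b c in
  (c ∨ m) ∧ not (majority (a ∨ m) (b ∨ m) (c ∨ m)) ≡ c ∧ not m
majority-closure true  true  true  = refl
majority-closure true  true  false = refl
majority-closure true  false true  = refl
majority-closure true  false false = refl
majority-closure false true  true  = refl
majority-closure false true  false = refl
majority-closure false false true  = refl
majority-closure false false false = refl

module _ {K : Set} where

  Covers : Bool → Subset K → List K → Set
  Covers b X xs = ∀ x → X x ≡ b → x ∈ xs

  module _ {_∙_ : Bool → Bool → Bool} {b : Bool} {X Y : Subset K} where

    covers-selective : Selective _≡_ _∙_ → ∀ {xs ys} →
      Covers b X xs → Covers b Y ys → Covers b (λ x → X x ∙ Y x) (xs ++ ys)
    covers-selective sel {xs} p q x e with sel (X x) (Y x)
    ... | inj₁ X∙Y≡X = ∈-++⁺ˡ (p x (trans (sym X∙Y≡X) e))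
    ... | inj₂ X∙Y≡Y = ∈-++⁺ʳ xs (q x (trans (sym X∙Y≡Y) e))

    covers-conicalˡ : LeftConical _≡_ b _∙_ → ∀ {xs} →
      Covers b X xs → Covers b (λ x → X x ∙ Y x) xs
    covers-conicalˡ conical p x e = p x (conical (X x) (Y x) e)

    covers-conicalʳ : RightConical _≡_ b _∙_ → ∀ {ys} →
      Covers b Y ys → Covers b (λ x → X x ∙ Y x) ys
    covers-conicalʳ conical q x e = q x (conical (X x) (Y x) e)

  InF-∪ : {X Y : Subset K} → InF X → InF Y → InF (X ∪ Y)
  InF-∪ (fin (xs , p))   (fin (ys , q)) = fin (xs ++ ys , covers-selective ∨-sel p q)
  InF-∪ (cofin (xs , p)) _              = cofin (xs , covers-conicalˡ ∨-conicalˡ p)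
  InF-∪ (fin _)          (cofin (ys , q)) = cofin (ys , covers-conicalʳ ∨-conicalʳ q)

  InF-∩ : {X Y : Subset K} → InF X → InF Y → InF (X ∩ Y)
  InF-∩ (cofin (xs , p)) (cofin (ys , q)) = cofin (xs ++ ys , covers-selective ∧-sel p q)
  InF-∩ (fin (xs , p))   _              = fin (xs , covers-conicalˡ ∧-conicalˡ p)
  InF-∩ (cofin _)        (fin (ys , q)) = fin (ys , covers-conicalʳ ∧-conicalʳ q)

  InF-μ : {A B C : Subset K} → InF A → InF B → InF C → InF (μ A B C)
  InF-μ fa fb fc = InF-∪ (InF-∪ (InF-∩ fa fb) (InF-∩ fa fc)) (InF-∩ fb fc)

  IsFinite-resp : {X Y : Subset K} → (∀ x → X x ≡ Y x) → IsFinite X → IsFinite Y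
  IsFinite-resp X≗Y (xs , p) = xs , λ x e → p x (trans (X≗Y x) e)

  private-part : Triple {K} → Subset K
  private-part ⟨ A , B , C ⟩ = C ∖ μ A B C

  private-part-closure : ∀ t x → private-part (closure t) x ≡ private-part t x
  private-part-closure ⟨ A , B , C ⟩ x = majority-closure (A x) (B x) (C x)

lemma3p2 : (K : Set) → Infinite K → (t : Triple {K}) → InT t → InT (closure t)
lemma3p2 K _ t@(⟨ A , B , C ⟩) (fa , fb , fc , private-finite) =
  InF-∪ fa fm , InF-∪ fb fm , InF-∪ fc fm ,
  IsFinite-resp (λ x → sym (private-part-closure t x)) private-finite
  where
  fm : InF (μ A B C)
  fm = InF-μ fa fb fc
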